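{- Let $S$ be a $(v,k,\mu)$ sum set in a finite group $G$ of order $v$, and let $n = k^2 - \mu v$. Then for every integer $m \ge 1$, in the integral group ring $\mathbb{Z}G$, \[ S^{2m} = \frac{1}{v}\left(k^{2m} - n^m\right) G + n^m. \]
   Context: For $a \in G$, the number of ways to write $a$ as a product in $S$ is the number of ordered pairs $(x,y) \in S\times S$ with $xy = a$. $S$ with $|S|=k$ is a $(v,k,\mu)$ sum set if every nonidentity element of $G$ can be written as a product in $S$ in exactly $\mu$ ways. In $\mathbb{Z}G$, a subset $X \subseteq G$ is identified with the element $\sum_{g\in X} g$ (so $G$ denotes $\sum_{g \in G} g$), an integer $c$ is identified with $c\cdot 1_G$, and $S^{j}$ denotes the $j$-th power of $S$ in the ring $\mathbb{Z}G$. -}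

module Defs where

open import Data.Nat using (ℕ; zero; suc)
open import Data.Fin using (Fin) renaming (zero to fz; suc to fs)
open import Data.Fin.Properties using (_≟_)
open import Data.Bool using (Bool; true; false)
open import Data.Integer using (ℤ; +_; _+_; _*_; 0ℤ; 1ℤ)
open import Relation.Binary.PropositionalEquality using (_≡_)
open import Relation.Nullary using (yes; no)
open import Algebra.Structures using (IsGroup)

-- A finite group of order v, with elements represented by Fin v
-- (every finite group is isomorphic to such a one).
record FiniteGroup : Set where
  field
    v       : ℕ
    _∙_     : Fin v → Fin v → Fin v
    ε       : Fin v
    _⁻¹     : Fin v → Fin v
    isGroup : IsGroup _≡_ _∙_ ε _⁻¹

Σℤ : (n : ℕ) → (Fin n → ℤ) → ℤ
Σℤ zero    f = 0ℤ
Σℤ (suc n) f = f fz + Σℤ n (λ i → f (fs i))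

𝟙 : Bool → ℤ
𝟙 true  = 1ℤ
𝟙 false = 0ℤ

module GroupRing (Γ : FiniteGroup) where
  open FiniteGroup Γ public

  [_≟_] : Fin v → Fin v → ℤ
  [ a ≟ b ] with a ≟ b
  ... | yes _ = 1ℤ
  ... | no  _ = 0ℤ

  ℤG : Set
  ℤG = Fin v → ℤ

  subsetElt : (Fin v → Bool) → ℤG
  subsetElt X g = 𝟙 (X g)

  -- The element G = Σ_{g ∈ G} g.
  Gelt : ℤG
  Gelt _ = 1ℤ

  -- The integer c viewed as c · 1_G.
  scalar : ℤ → ℤG
  scalar c g = c * [ g ≟ ε ]

  _⊕_ : ℤG → ℤG → ℤG
  (x ⊕ y) g = x g + y g

  _⊛_ : ℤ → ℤG → ℤG
  (c ⊛ x) g = c * x g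

  -- Product in ℤG: (x y)(a) = Σ_{g h = a} x(g) y(h) = Σ_g x(g) y(g⁻¹ a).
  _⊗_ : ℤG → ℤG → ℤG
  (x ⊗ y) a = Σℤ v (λ g → x g * y ((g ⁻¹) ∙ a))

  _^^_ : ℤG → ℕ → ℤG
  x ^^ zero  = scalar 1ℤ
  x ^^ suc j = x ⊗ (x ^^ j)

  card : (Fin v → Bool) → ℤ
  card S = Σℤ v (λ g → 𝟙 (S g))

  reps : (Fin v → Bool) → Fin v → ℤ
  reps S a = Σℤ v (λ x → Σℤ v (λ y → 𝟙 (S x) * 𝟙 (S y) * [ x ∙ y ≟ a ]))

  IsSumSet : (Fin v → Bool) → ℕ → ℕ → Set
  IsSumSet S k μ = card S ≡ + k × (∀ a → ¬ (a ≡ ε) → reps S a ≡ + μ)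
    where
      open import Data.Product using (_×_)
      open import Relation.Nullary using (¬_)

-- The augmentation Σ_g x(g) is multiplicative, so S² has augmentation k²; as S² has coefficient
-- μ off the identity, its coefficient at the identity is k² − μ(v − 1) = μ + n, i.e. S² = μG + n.
-- Since S·G = kG, multiplying c·G + t by S² gives (c k² + t μ)·G + t n, so S^(2m) = c_m G + n^m
-- with c_(m+1) = c_m k² + n^m μ, and induction on m gives c_m v = k^(2m) − n^m.
module Submission where

open import Defs
open import Level using (0ℓ)
open import Data.Nat using (ℕ; zero; suc; _≥_) renaming (_*_ to _*ℕ_)
open import Data.Nat.Properties using (*-suc)
open import Data.Fin using (Fin) renaming (zero to fz; suc to fs)
open import Data.Fin.Properties using (_≟_; suc-injective)
open import Data.Bool using (Bool)
open import Data.Integer using (ℤ; +_; _+_; _-_; _*_; _^_; 0ℤ; 1ℤ)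
open import Data.Integer.Properties
  using (*-comm; *-zeroʳ; *-identityˡ; *-identityʳ; +-identityˡ; +-identityʳ; *-distribˡ-+)
open import Data.Integer.Tactic.RingSolver using (solve-∀)
open import Data.Product using (Σ; _×_; _,_; proj₁; proj₂)
open import Data.Empty using (⊥-elim)
open import Function using (_∘_)
open import Relation.Binary.PropositionalEquality
  using (_≡_; _≢_; refl; sym; trans; subst; cong; cong₂; module ≡-Reasoning)
open import Relation.Nullary using (yes; no)
open import Algebra.Bundles using (Group)
import Algebra.Properties.Group as GroupProperties

open ≡-Reasoning

Σℤ-cong : ∀ n {f g : Fin n → ℤ} → (∀ i → f i ≡ g i) → Σℤ n f ≡ Σℤ n g
Σℤ-cong zero    f≗g = refl
Σℤ-cong (suc n) f≗g = cong₂ _+_ (f≗g fz) (Σℤ-cong n (f≗g ∘ fs))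

Σℤ-+ : ∀ n (f g : Fin n → ℤ) → Σℤ n (λ i → f i + g i) ≡ Σℤ n f + Σℤ n g
Σℤ-+ zero    f g = refl
Σℤ-+ (suc n) f g = trans (cong (_+_ (f fz + g fz)) (Σℤ-+ n (f ∘ fs) (g ∘ fs)))
  (interchange (f fz) (g fz) (Σℤ n (f ∘ fs)) (Σℤ n (g ∘ fs)))
  where
  interchange : ∀ a b c d → (a + b) + (c + d) ≡ (a + c) + (b + d)
  interchange = solve-∀

Σℤ-*ˡ : ∀ n c (f : Fin n → ℤ) → Σℤ n (λ i → c * f i) ≡ c * Σℤ n f
Σℤ-*ˡ zero    c f = sym (*-zeroʳ c)
Σℤ-*ˡ (suc n) c f = trans (cong (_+_ (c * f fz)) (Σℤ-*ˡ n c (f ∘ fs)))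
  (sym (*-distribˡ-+ c (f fz) _))

Σℤ-const : ∀ n c → Σℤ n (λ _ → c) ≡ + n * c
Σℤ-const zero    c = refl
Σℤ-const (suc n) c = trans (cong (_+_ c) (Σℤ-const n c)) (succ-* c (+ n))
  where
  succ-* : ∀ c N → c + N * c ≡ (1ℤ + N) * c
  succ-* = solve-∀

Σℤ-zero : ∀ n {f : Fin n → ℤ} → (∀ i → f i ≡ 0ℤ) → Σℤ n f ≡ 0ℤ
Σℤ-zero n f≗0 = trans (Σℤ-cong n f≗0) (trans (Σℤ-const n 0ℤ) (*-zeroʳ (+ n)))

Σℤ-swap : ∀ n m (F : Fin n → Fin m → ℤ) →
  Σℤ n (λ i → Σℤ m (F i)) ≡ Σℤ m (λ j → Σℤ n (λ i → F i j))
Σℤ-swap zero    m F = sym (Σℤ-zero m (λ _ → refl))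
Σℤ-swap (suc n) m F = trans (cong (_+_ (Σℤ m (F fz))) (Σℤ-swap n m (F ∘ fs)))
  (sym (Σℤ-+ m (F fz) _))

Σℤ-select : ∀ n (f d : Fin n → ℤ) b → d b ≡ 1ℤ → (∀ i → i ≢ b → d i ≡ 0ℤ) →
  Σℤ n (λ i → f i * d i) ≡ f b
Σℤ-select (suc n) f d fz db≡1 d≡0 = begin
  f fz * d fz + Σℤ n (λ i → f (fs i) * d (fs i))
    ≡⟨ cong₂ _+_ (trans (cong (f fz *_) db≡1) (*-identityʳ (f fz)))
         (Σℤ-zero n (λ i → trans (cong (f (fs i) *_) (d≡0 (fs i) (λ ()))) (*-zeroʳ (f (fs i))))) ⟩
  f fz + 0ℤ
    ≡⟨ +-identityʳ (f fz) ⟩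
  f fz ∎
Σℤ-select (suc n) f d (fs b) db≡1 d≡0 = begin
  f fz * d fz + Σℤ n (λ i → f (fs i) * d (fs i))
    ≡⟨ cong₂ _+_ (trans (cong (f fz *_) (d≡0 fz (λ ()))) (*-zeroʳ (f fz)))
         (Σℤ-select n (f ∘ fs) (d ∘ fs) b db≡1 (λ i i≢b → d≡0 (fs i) (i≢b ∘ suc-injective))) ⟩
  0ℤ + f (fs b)
    ≡⟨ +-identityˡ _ ⟩
  f (fs b) ∎

coefficient-step : ∀ C P Q k μ v → C * v ≡ P - Q →
  (C * (k * k) + Q * μ) * v ≡ k * (k * P) - (k * k - μ * v) * Q
coefficient-step C P Q k μ v Cv≡P-Q = begin
  (C * (k * k) + Q * μ) * v       ≡⟨ expand C k Q μ v ⟩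
  (C * v) * (k * k) + Q * (μ * v) ≡⟨ cong (λ z → z * (k * k) + Q * (μ * v)) Cv≡P-Q ⟩
  (P - Q) * (k * k) + Q * (μ * v) ≡⟨ collect P Q k μ v ⟩
  k * (k * P) - (k * k - μ * v) * Q ∎
  where
  expand : ∀ C k Q μ v → (C * (k * k) + Q * μ) * v ≡ (C * v) * (k * k) + Q * (μ * v)
  expand = solve-∀
  collect : ∀ P Q k μ v → (P - Q) * (k * k) + Q * (μ * v) ≡ k * (k * P) - (k * k - μ * v) * Q
  collect = solve-∀

module GroupRingProperties (Γ : FiniteGroup) where
  open GroupRing Γ

  group : Group 0ℓ 0ℓ
  group = record { Carrier = Fin v ; _≈_ = _≡_ ; _∙_ = _∙_ ; ε = ε ; _⁻¹ = _⁻¹ ; isGroup = isGroup }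

  open Group group using (inverseˡ)
  open GroupProperties group using (\\-leftDividesˡ; y≈x\\z; inverseˡ-unique; ⁻¹-injective)

  δε : ℤG
  δε b = [ b ≟ ε ]

  [≟]-≡ : ∀ {a b} → a ≡ b → [ a ≟ b ] ≡ 1ℤ
  [≟]-≡ {a} {b} a≡b with a ≟ b
  ... | yes _   = refl
  ... | no  a≢b = ⊥-elim (a≢b a≡b)

  [≟]-≢ : ∀ {a b} → a ≢ b → [ a ≟ b ] ≡ 0ℤ
  [≟]-≢ {a} {b} a≢b with a ≟ b
  ... | yes a≡b = ⊥-elim (a≢b a≡b)
  ... | no  _   = refl

  Σ-[≟] : ∀ (f : ℤG) (φ : Fin v → Fin v) {b c} → φ b ≡ c → (∀ i → φ i ≡ c → i ≡ b) →
    Σℤ v (λ i → f i * [ φ i ≟ c ]) ≡ f b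
  Σ-[≟] f φ {b} {c} φb≡c φi≡c⇒i≡b =
    Σℤ-select v f (λ i → [ φ i ≟ c ]) b ([≟]-≡ φb≡c) (λ i i≢b → [≟]-≢ (i≢b ∘ φi≡c⇒i≡b i))

  Σ-[x∙y≟a] : ∀ (f : ℤG) x a → Σℤ v (λ y → f y * [ x ∙ y ≟ a ]) ≡ f ((x ⁻¹) ∙ a)
  Σ-[x∙y≟a] f x a = Σ-[≟] f (x ∙_) (\\-leftDividesˡ x a) (λ y → y≈x\\z x y a)

  Σ-[a≟b] : ∀ a → Σℤ v (λ b → [ a ≟ b ]) ≡ 1ℤ
  Σ-[a≟b] a = begin
    Σℤ v (λ b → [ a ≟ b ])        ≡⟨ Σℤ-cong v (λ b → sym (*-identityˡ [ a ≟ b ])) ⟩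
    Σℤ v (λ b → 1ℤ * [ a ≟ b ])   ≡⟨ Σℤ-select v _ _ a ([≟]-≡ refl) (λ b b≢a → [≟]-≢ (b≢a ∘ sym)) ⟩
    1ℤ ∎

  Σ-δε : Σℤ v δε ≡ 1ℤ
  Σ-δε = trans (Σℤ-cong v (λ b → sym (*-identityˡ (δε b))))
    (Σ-[≟] (λ _ → 1ℤ) (λ b → b) refl (λ _ b≡ε → b≡ε))

  ⊗-δε : ∀ (y : ℤG) a → (y ⊗ δε) a ≡ y a
  ⊗-δε y a = Σ-[≟] y (λ g → (g ⁻¹) ∙ a) (inverseˡ a)
    (λ g g⁻¹a≡ε → ⁻¹-injective (inverseˡ-unique (g ⁻¹) a g⁻¹a≡ε))

  ⊗-affineʳ : ∀ (y x z : ℤG) c t → (∀ b → x b ≡ c + t * z b) →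
    ∀ a → (y ⊗ x) a ≡ c * Σℤ v y + t * (y ⊗ z) a
  ⊗-affineʳ y x z c t x≡cG+tz a = begin
    Σℤ v (λ g → y g * x ((g ⁻¹) ∙ a))
      ≡⟨ Σℤ-cong v (λ g → trans (cong (y g *_) (x≡cG+tz _))
           (distribute (y g) c t (z ((g ⁻¹) ∙ a)))) ⟩
    Σℤ v (λ g → c * y g + t * (y g * z ((g ⁻¹) ∙ a)))
      ≡⟨ Σℤ-+ v _ _ ⟩
    Σℤ v (λ g → c * y g) + Σℤ v (λ g → t * (y g * z ((g ⁻¹) ∙ a)))
      ≡⟨ cong₂ _+_ (Σℤ-*ˡ v c y) (Σℤ-*ˡ v t _) ⟩
    c * Σℤ v y + t * (y ⊗ z) a ∎
    where
    distribute : ∀ p c t q → p * (c + t * q) ≡ c * p + t * (p * q)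
    distribute = solve-∀

  Σ-translate : ∀ (y : ℤG) g → Σℤ v (λ a → y ((g ⁻¹) ∙ a)) ≡ Σℤ v y
  Σ-translate y g = begin
    Σℤ v (λ a → y ((g ⁻¹) ∙ a))
      ≡⟨ Σℤ-cong v (λ a → sym (Σ-[x∙y≟a] y g a)) ⟩
    Σℤ v (λ a → Σℤ v (λ h → y h * [ g ∙ h ≟ a ]))
      ≡⟨ Σℤ-swap v v _ ⟩
    Σℤ v (λ h → Σℤ v (λ a → y h * [ g ∙ h ≟ a ]))
      ≡⟨ Σℤ-cong v (λ h → trans (Σℤ-*ˡ v (y h) _)
           (trans (cong (y h *_) (Σ-[a≟b] (g ∙ h))) (*-identityʳ (y h)))) ⟩
    Σℤ v y ∎

  Σ-⊗ : ∀ (x y : ℤG) → Σℤ v (x ⊗ y) ≡ Σℤ v x * Σℤ v y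
  Σ-⊗ x y = begin
    Σℤ v (λ a → Σℤ v (λ g → x g * y ((g ⁻¹) ∙ a)))
      ≡⟨ Σℤ-swap v v _ ⟩
    Σℤ v (λ g → Σℤ v (λ a → x g * y ((g ⁻¹) ∙ a)))
      ≡⟨ Σℤ-cong v (λ g → trans (Σℤ-*ˡ v (x g) _) (cong (x g *_) (Σ-translate y g))) ⟩
    Σℤ v (λ g → x g * Σℤ v y)
      ≡⟨ Σℤ-cong v (λ g → *-comm (x g) _) ⟩
    Σℤ v (λ g → Σℤ v y * x g)
      ≡⟨ Σℤ-*ˡ v (Σℤ v y) x ⟩
    Σℤ v y * Σℤ v x
      ≡⟨ *-comm (Σℤ v y) _ ⟩
    Σℤ v x * Σℤ v y ∎

  const-off-ε : ∀ (f : ℤG) c → (∀ b → b ≢ ε → f b ≡ c) →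
    ∀ a → f a ≡ c + (Σℤ v f - c * + v) * δε a
  const-off-ε f c f≡c a = trans (decomposition a) (cong (λ z → c + z * δε a) excess-at-ε)
    where
    decomposition : ∀ a → f a ≡ c + (f ε - c) * δε a
    decomposition a with a ≟ ε
    ... | yes refl = sym (cancel (f ε) c)
      where
      cancel : ∀ r c → c + (r - c) * 1ℤ ≡ r
      cancel = solve-∀
    ... | no  a≢ε  = begin
      f a                ≡⟨ f≡c a a≢ε ⟩
      c                  ≡⟨ +-identityʳ c ⟨
      c + 0ℤ             ≡⟨ cong (_+_ c) (*-zeroʳ (f ε - c)) ⟨
      c + (f ε - c) * 0ℤ ∎

    Σf≡ : Σℤ v f ≡ + v * c + (f ε - c)
    Σf≡ = begin
      Σℤ v f
        ≡⟨ Σℤ-cong v decomposition ⟩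
      Σℤ v (λ a → c + (f ε - c) * δε a)
        ≡⟨ Σℤ-+ v _ _ ⟩
      Σℤ v (λ _ → c) + Σℤ v (λ a → (f ε - c) * δε a)
        ≡⟨ cong₂ _+_ (Σℤ-const v c) (trans (Σℤ-*ˡ v (f ε - c) δε) (cong ((f ε - c) *_) Σ-δε)) ⟩
      + v * c + (f ε - c) * 1ℤ
        ≡⟨ cong (_+_ (+ v * c)) (*-identityʳ (f ε - c)) ⟩
      + v * c + (f ε - c) ∎

    excess-at-ε : f ε - c ≡ Σℤ v f - c * + v
    excess-at-ε = trans (rearrange (+ v) c (f ε - c)) (cong (_- c * + v) (sym Σf≡))
      where
      rearrange : ∀ v c x → x ≡ (v * c + x) - c * v
      rearrange = solve-∀

  module SumSet (S : Fin v → Bool) (k μ : ℕ) (isSumSet : IsSumSet S k μ) where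
    s : ℤG
    s = subsetElt S

    n : ℤ
    n = + k * + k - + μ * + v

    Σs : Σℤ v s ≡ + k
    Σs = proj₁ isSumSet

    s⊗s≡reps : ∀ a → (s ⊗ s) a ≡ reps S a
    s⊗s≡reps a = sym (Σℤ-cong v (λ x → Σ-[x∙y≟a] (λ y → 𝟙 (S x) * 𝟙 (S y)) x a))

    square : ∀ a → (s ⊗ s) a ≡ + μ + n * δε a
    square a = begin
      (s ⊗ s) a
        ≡⟨ const-off-ε (s ⊗ s) (+ μ) (λ b b≢ε → trans (s⊗s≡reps b) (proj₂ isSumSet b b≢ε)) a ⟩
      + μ + (Σℤ v (s ⊗ s) - + μ * + v) * δε a
        ≡⟨ cong (λ z → + μ + (z - + μ * + v) * δε a) (trans (Σ-⊗ s s) (cong₂ _*_ Σs Σs)) ⟩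
      + μ + n * δε a ∎

    coefficient : ℕ → ℤ
    coefficient zero    = 0ℤ
    coefficient (suc m) = coefficient m * (+ k * + k) + n ^ m * + μ

    s⊗s⊗-affine : ∀ (x : ℤG) C t → (∀ b → x b ≡ C + t * δε b) →
      ∀ a → (s ⊗ (s ⊗ x)) a ≡ (C * (+ k * + k) + t * + μ) + (n * t) * δε a
    s⊗s⊗-affine x C t x≡ a = begin
      (s ⊗ (s ⊗ x)) a
        ≡⟨ ⊗-affineʳ s (s ⊗ x) s (C * + k) t s⊗x≡ a ⟩
      C * + k * Σℤ v s + t * (s ⊗ s) a
        ≡⟨ cong₂ (λ p q → C * + k * p + t * q) Σs (square a) ⟩
      C * + k * + k + t * (+ μ + n * δε a)
        ≡⟨ regroup C (+ k) t (+ μ) n (δε a) ⟩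
      (C * (+ k * + k) + t * + μ) + (n * t) * δε a ∎
      where
      s⊗x≡ : ∀ b → (s ⊗ x) b ≡ C * + k + t * s b
      s⊗x≡ b = trans (⊗-affineʳ s x δε C t x≡ b) (cong₂ (λ p q → C * p + t * q) Σs (⊗-δε s b))
      regroup : ∀ C k t μ n d → C * k * k + t * (μ + n * d) ≡ (C * (k * k) + t * μ) + (n * t) * d
      regroup = solve-∀

    power : ∀ m a → (s ^^ (2 *ℕ m)) a ≡ coefficient m + n ^ m * δε a
    power zero    a = sym (+-identityˡ _)
    power (suc m) a =
      subst (λ j → (s ^^ j) a ≡ coefficient (suc m) + n ^ suc m * δε a) (sym (*-suc 2 m))
        (s⊗s⊗-affine (s ^^ (2 *ℕ m)) (coefficient m) (n ^ m) (power m) a)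

    coefficient-*-v : ∀ m → coefficient m * + v ≡ (+ k) ^ (2 *ℕ m) - n ^ m
    coefficient-*-v zero    = refl
    coefficient-*-v (suc m) =
      subst (λ j → coefficient (suc m) * + v ≡ (+ k) ^ j - n ^ suc m) (sym (*-suc 2 m))
        (coefficient-step (coefficient m) ((+ k) ^ (2 *ℕ m)) (n ^ m) (+ k) (+ μ) (+ v)
          (coefficient-*-v m))

lemma4p1 : (Γ : FiniteGroup) → let open GroupRing Γ in
    (S : Fin v → Bool) (k μ : ℕ) → IsSumSet S k μ →
    (m : ℕ) → m ≥ 1 →
    let n = + k * + k - + μ * + v in
    Σ ℤ (λ c → (c * + v ≡ (+ k) ^ (2 *ℕ m) - n ^ m) ×
      (∀ a → (subsetElt S ^^ (2 *ℕ m)) a ≡ ((c ⊛ Gelt) ⊕ scalar (n ^ m)) a))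
lemma4p1 Γ S k μ isSumSet m _ =
  coefficient m , coefficient-*-v m ,
  λ a → trans (power m a) (cong (_+ _) (sym (*-identityʳ (coefficient m))))
  where
  open GroupRingProperties Γ
  open SumSet S k μ isSumSet
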